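{- Let $G$ be a graph, $T \subseteq V(G)$, and $x \in V(G)$ such that $\{x\}$ is a multiway near-separator of $(G,T)$. Let $\mathcal{F}$ be a rooted block-cut forest of $G-\{x\}$, let $t\in T$ be a cut vertex of $G - \{x\}$ (a node of $\mathcal{F}$), and let $\mathcal{C}(t)$ be the set of grandchildren of $t$ in $\mathcal{F}$. Then $\mathcal{C}(t)\cap T = \emptyset$.
   Context: All graphs are finite, simple and undirected. Given $G$ and $T\subseteq V(G)$, a set $S\subseteq V(G)$ is a multiway near-separator of $(G,T)$ if $S\cap T=\emptyset$ and no pair of distinct $t_i,t_j\in T$ is joined by two internally vertex-disjoint paths in $G-S$ (an edge $t_it_j$ counts as two such paths). A block of a graph is a maximal connected subgraph without a cut vertex; the block-cut graph has as nodes the cut vertices and blocks, with a cut vertex $a$ adjacent to block $B$ iff $a\in V(B)$; for a connected graph it is a tree. A rooted block-cut forest of a graph consists of the block-cut trees of its connected components, each rooted at an arbitrary block, with the induced parent/child relation. For a cut vertex $v$, its grandchildren $\mathcal{C}(v)$ are the union over children $y$ of $v$ of the children of $y$ (these are cut vertices). -}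

module Defs where

open import Data.Nat using (ℕ)
open import Data.Fin using (Fin)
open import Data.Fin.Subset using (Subset; _∈_; _∉_; _⊆_; _-_; Nonempty)
open import Data.List using (List; []; _∷_; _++_)
open import Data.List.Relation.Unary.All using (All)
open import Data.List.Relation.Unary.Linked using (Linked)
open import Data.List.Relation.Unary.Unique.Propositional using (Unique)
import Data.List.Membership.Propositional as LM
open import Data.Sum using (_⊎_; inj₁; inj₂)
open import Data.Product using (Σ; _×_; ∃; ∃-syntax; _,_)
open import Relation.Nullary using (¬_)
open import Relation.Binary.PropositionalEquality using (_≡_; _≢_)
open import Relation.Binary.Construct.Closure.ReflexiveTransitive using (Star)

record Graph (n : ℕ) : Set₁ where
  field
    Adj    : Fin n → Fin n → Set
    sym    : ∀ {u v} → Adj u v → Adj v u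
    irrefl : ∀ {u} → ¬ Adj u u
open Graph public

module _ {n : ℕ} (G : Graph n) where

  IsPathAvoiding : Subset n → Fin n → Fin n → List (Fin n) → Set
  IsPathAvoiding S u v I =
    Linked (Adj G) (u ∷ I ++ (v ∷ [])) ×
    Unique (u ∷ I ++ (v ∷ [])) ×
    All (_∉ S) (u ∷ I ++ (v ∷ []))

  -- u and v are joined by two internally vertex-disjoint paths in G - S.
  -- (If u v is an edge, taking both interiors empty shows that an edge
  -- counts as two such paths, as in the paper's convention.)
  TwoDisjointPaths : Subset n → Fin n → Fin n → Set
  TwoDisjointPaths S u v =
    Σ (List (Fin n)) λ I₁ → Σ (List (Fin n)) λ I₂ →
      IsPathAvoiding S u v I₁ × IsPathAvoiding S u v I₂ ×
      (∀ z → z LM.∈ I₁ → ¬ (z LM.∈ I₂))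

  IsMultiwayNearSeparator : Subset n → Subset n → Set
  IsMultiwayNearSeparator T S =
    (∀ v → v ∈ S → v ∉ T) ×
    (∀ tᵢ tⱼ → tᵢ ∈ T → tⱼ ∈ T → tᵢ ≢ tⱼ → ¬ TwoDisjointPaths S tᵢ tⱼ)

  AdjIn : Subset n → Fin n → Fin n → Set
  AdjIn W u v = u ∈ W × v ∈ W × Adj G u v

  ConnIn : Subset n → Fin n → Fin n → Set
  ConnIn W u v = u ∈ W × v ∈ W × Star (AdjIn W) u v

  Connected : Subset n → Set
  Connected W = Nonempty W × (∀ u v → u ∈ W → v ∈ W → ConnIn W u v)

  -- v is a cut vertex of G[W]: deleting v increases the number of
  -- components, i.e. some two vertices of G[W] - v that are connected
  -- in G[W] become disconnected in G[W] - v.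
  IsCutVertex : Subset n → Fin n → Set
  IsCutVertex W v =
    v ∈ W × ∃[ u ] ∃[ w ] (u ∈ W - v × w ∈ W - v × ConnIn W u w × ¬ ConnIn (W - v) u w)

  NoCutVertex : Subset n → Set
  NoCutVertex B = ∀ v → ¬ IsCutVertex B v

  -- B is (the vertex set of) a block of G[W]: a maximal connected
  -- subgraph without a cut vertex.  (Maximal such subgraphs are induced,
  -- so they are determined by their vertex sets.)
  IsBlock : Subset n → Subset n → Set
  IsBlock W B =
    B ⊆ W × Connected B × NoCutVertex B ×
    (∀ B' → B ⊆ B' → B' ⊆ W → Connected B' → NoCutVertex B' → B' ⊆ B)

  -- Block-cut graph of G[W]: nodes are cut vertices (inj₁) and blocks (inj₂)

  BCNode : Set
  BCNode = Fin n ⊎ Subset n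

  data BCAdj (W : Subset n) : BCNode → BCNode → Set where
    cut-blk : ∀ {a B} → IsCutVertex W a → IsBlock W B → a ∈ B → BCAdj W (inj₁ a) (inj₂ B)
    blk-cut : ∀ {a B} → IsCutVertex W a → IsBlock W B → a ∈ B → BCAdj W (inj₂ B) (inj₁ a)

  IsBCNode : Subset n → BCNode → Set
  IsBCNode W (inj₁ a) = IsCutVertex W a
  IsBCNode W (inj₂ B) = IsBlock W B

  BCAdjAvoiding : Subset n → BCNode → BCNode → BCNode → Set
  BCAdjAvoiding W y p q = BCAdj W p q × p ≢ y × q ≢ y

  record RootedBCForest (W : Subset n) : Set₁ where
    field
      Root       : Subset n → Set
      root-block : ∀ B → Root B → IsBlock W B
      root-exists : ∀ N → IsBCNode W N → ∃[ R ] (Root R × Star (BCAdj W) N (inj₂ R))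
      root-unique : ∀ N R R' → Root R → Root R' →
                    Star (BCAdj W) N (inj₂ R) → Star (BCAdj W) N (inj₂ R') → R ≡ R'

  -- Induced parent relation: p is the parent of y iff p is a neighbour of
  -- y in the block-cut forest lying on the tree path from y to the root,
  -- i.e. p reaches the root of its component without passing through y.
  ParentOf : {W : Subset n} → RootedBCForest W → BCNode → BCNode → Set
  ParentOf {W} F p y =
    BCAdj W y p × ∃[ R ] (RootedBCForest.Root F R × Star (BCAdjAvoiding W y) p (inj₂ R))

  IsGrandchild : {W : Subset n} → RootedBCForest W → Fin n → Fin n → Set
  IsGrandchild F t c = ∃[ y ] (ParentOf F (inj₁ t) y × ParentOf F y (inj₁ c))

{-# OPTIONS --safe #-}
-- The child B of t of which c is a child is a block of G − x containing t and c.
--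
-- If c ≠ t, then t and c lie in the 2-connected set B, which avoids x, so they are joined by two
-- internally disjoint paths (Whitney: grow such a pair along a walk, rerouting at each new vertex
-- around the previous one); hence c ∉ T.
--
-- If c = t, then t would be both parent and child of B, and both lead to the same root R. Along
-- the block-cut path from B to R avoiding t, every vertex other than t is reachable from B − t in
-- G − x − t; along the path from t to R avoiding B, none is, because a block through t containing
-- such a vertex forms, with B and a connecting path, a 2-connected set, and so equals B. The cut
-- vertex through which the first path enters R violates both.
module Submission where

open import Defs
open import Level using (0ℓ)
open import Data.Nat using (ℕ)
open import Data.Fin using (Fin; _≟_)
open import Data.Fin.Subset using (Subset; _∈_; _∉_; ⁅_⁆; ∁; _-_; _─_; _⊆_)
open import Data.Fin.Subset.Properties
  using (_∈?_; x∈p∧x≢y⇒x∈p-y; x∉⁅y⁆⇒x≢y; x∈∁p⇒x∉p; p─q⊆p; ⊆-antisym)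
open import Data.List using (List; []; _∷_; _++_)
open import Data.List.Membership.Propositional using () renaming (_∈_ to _∈ˡ_; _∉_ to _∉ˡ_)
open import Data.List.Membership.Propositional.Properties using (∈-++⁺ˡ; ∈-++⁺ʳ; ∈-++⁻)
open import Data.List.Relation.Unary.Any using (here; there)
import Data.List.Relation.Unary.All as All
import Data.List.Relation.Unary.All.Properties as All
open import Data.List.Relation.Unary.AllPairs using (_∷_)
open import Data.List.Relation.Unary.Unique.Propositional using (Unique; [])
open import Data.List.Relation.Unary.Unique.Propositional.Properties
  using (Unique[x∷xs]⇒x∉xs) renaming (++⁺ to Unique-++⁺)
open import Data.List.Relation.Unary.Linked using (Linked; [-]; _∷_)
open import Data.List.Relation.Binary.Disjoint.Propositional using (Disjoint)
open import Data.Vec using (tabulate)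
open import Data.Vec.Properties using (lookup∘tabulate; lookup⇒[]=; []=⇒lookup)
open import Data.Sum using (_⊎_; inj₁; inj₂; [_,_]′)
open import Data.Product using (_×_; ∃₂; ∃-syntax; _,_; proj₁; proj₂)
open import Data.Empty using (⊥-elim)
open import Effect.Monad using (RawMonad)
open import Function using (_∘_; id)
open import Relation.Unary using (Pred; Decidable)
open import Relation.Nullary using (¬_; Dec; yes; no; does)
open import Relation.Nullary.Decidable using (dec-true; _⊎-dec_)
open import Relation.Nullary.Negation using (¬¬-Monad; contradiction)
open import Relation.Nullary.Negation.Core using (DoubleNegation)
open import Relation.Binary.PropositionalEquality as ≡ using (_≡_; _≢_; refl; trans; cong; subst)
open import Relation.Binary.Construct.Closure.ReflexiveTransitive as Star
  using (Star; ε; _◅_; _◅◅_)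

-- Adjacency is not assumed decidable, so connectivity facts are only available under double
-- negation; this suffices because the goal is itself a negation.
open RawMonad (¬¬-Monad {a = 0ℓ}) using (_>>=_; pure; _<$>_)

module _ where
  open import Data.Vec.Base using (_∷_; here; there)

  x∈p─q⇒x∉q : ∀ {n} (p q : Subset n) {x} → x ∈ p ─ q → x ∉ q
  x∈p─q⇒x∉q (_ ∷ p) (_ ∷ q) (there x∈) (there x∈q) = x∈p─q⇒x∉q p q x∈ x∈q

x∈p-y⇒x∈p : ∀ {n} {p : Subset n} {x y} → x ∈ p - y → x ∈ p
x∈p-y⇒x∈p {p = p} {y = y} = p─q⊆p p ⁅ y ⁆

x∈p-y⇒x≢y : ∀ {n} {p : Subset n} {x y} → x ∈ p - y → x ≢ y
x∈p-y⇒x≢y {p = p} {y = y} x∈ = x∉⁅y⁆⇒x≢y (x∈p─q⇒x∉q p ⁅ y ⁆ x∈)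

p⊆q⇒p-y⊆q-y : ∀ {n} {p q : Subset n} {y} → p ⊆ q → p - y ⊆ q - y
p⊆q⇒p-y⊆q-y p⊆q x∈ = x∈p∧x≢y⇒x∈p-y (p⊆q (x∈p-y⇒x∈p x∈)) (x∈p-y⇒x≢y x∈)

module _ {n : ℕ} {P : Pred (Fin n) 0ℓ} (P? : Decidable P) where

  fromDec : Subset n
  fromDec = tabulate (does ∘ P?)

  ∈-fromDec⁺ : ∀ {i} → P i → i ∈ fromDec
  ∈-fromDec⁺ {i} Pi =
    lookup⇒[]= i fromDec (trans (lookup∘tabulate (does ∘ P?) i) (dec-true (P? i) Pi))

  ∈-fromDec⁻ : ∀ {i} → i ∈ fromDec → P i
  ∈-fromDec⁻ {i} i∈ with P? i | trans (≡.sym (lookup∘tabulate (does ∘ P?) i)) ([]=⇒lookup i∈)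
  ... | yes Pi | _ = Pi
  ... | no _ | ()

module _ {A : Set} where

  Unique-∷⁺ : ∀ {a : A} {xs} → a ∉ˡ xs → Unique xs → Unique (a ∷ xs)
  Unique-∷⁺ a∉ u = All.¬Any⇒All¬ _ a∉ ∷ u

  Unique-++⁻ˡ : ∀ (xs : List A) {ys} → Unique (xs ++ ys) → Unique xs
  Unique-++⁻ˡ []       _          = []
  Unique-++⁻ˡ (x ∷ xs) (x∉ ∷ u) = All.++⁻ˡ xs x∉ ∷ Unique-++⁻ˡ xs u

  Unique-++⁻ʳ : ∀ (xs : List A) {ys} → Unique (xs ++ ys) → Unique ys
  Unique-++⁻ʳ []       u       = u
  Unique-++⁻ʳ (x ∷ xs) (_ ∷ u) = Unique-++⁻ʳ xs u

  Unique-++⇒Disjoint : ∀ (xs : List A) {ys} → Unique (xs ++ ys) → Disjoint xs ys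
  Unique-++⇒Disjoint (x ∷ xs) (x∉ ∷ _) (here refl , v∈ys) = All.lookup (All.++⁻ʳ xs x∉) v∈ys refl
  Unique-++⇒Disjoint (x ∷ xs) (_ ∷ u)  (there v∈xs , v∈ys) = Unique-++⇒Disjoint xs u (v∈xs , v∈ys)

  suffix⊆tail : ∀ {a b : A} {xs post} pre → b ∷ xs ≡ pre ++ a ∷ post → ∀ {z} → z ∈ˡ post → z ∈ˡ xs
  suffix⊆tail []        refl z∈ = z∈
  suffix⊆tail (_ ∷ pre) refl z∈ = ∈-++⁺ʳ pre (there z∈)

  ∈-prefix : ∀ {xs pre post} {s z : A} → xs ≡ pre ++ s ∷ post → z ∈ˡ pre ++ s ∷ [] → z ∈ˡ xs
  ∈-prefix {pre = pre} refl z∈ with ∈-++⁻ pre z∈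
  ... | inj₁ z∈pre       = ∈-++⁺ˡ z∈pre
  ... | inj₂ (here refl) = ∈-++⁺ʳ pre (here refl)

  ∈-suffix : ∀ {xs pre post} {s z : A} → xs ≡ pre ++ s ∷ post → z ∈ˡ s ∷ post → z ∈ˡ xs
  ∈-suffix {pre = pre} refl = ∈-++⁺ʳ pre

Star-last : ∀ {I : Set} {T : I → I → Set} {a b} → Star T a b → a ≡ b ⊎ ∃[ c ] T c b
Star-last ε = inj₁ refl
Star-last (step ◅ steps) with Star-last steps
... | inj₁ refl = inj₂ (_ , step)
... | inj₂ last = inj₂ last

transport-along : ∀ {I : Set} {T : I → I → Set} (P : I → Set) →
  (∀ {a b} → T a b → P a → P b) → ∀ {a b} → Star T a b → P a → P b
transport-along P f ε        = λ Pa → Pa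
transport-along P f (t ◅ ts) = transport-along P f ts ∘ f t

module _ {n : ℕ} (G : Graph n) where
  open import Data.List.Membership.DecPropositional (_≟_ {n}) using () renaming (_∈?_ to _∈ˡ?_)

  Walk : Subset n → Fin n → Fin n → Set
  Walk A = Star (AdjIn G A)

  walk-mono : ∀ {A A′} → A ⊆ A′ → ∀ {a b} → Walk A a b → Walk A′ a b
  walk-mono A⊆A′ = Star.map (λ (a∈ , b∈ , e) → A⊆A′ a∈ , A⊆A′ b∈ , e)

  walk-reverse : ∀ {A a b} → Walk A a b → Walk A b a
  walk-reverse = Star.reverse (λ (a∈ , b∈ , e) → b∈ , a∈ , sym G e)

  data Path : Fin n → Fin n → List (Fin n) → Set where
    [_]ᵖ : ∀ a → Path a a (a ∷ [])
    _∷ᵖ_ : ∀ {a b c vs} → Adj G a b → Path b c (b ∷ vs) → Path a c (a ∷ b ∷ vs)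

  infixr 5 _∷ᵖ_ _◂_ _++ᵖ_

  _◂_ : ∀ {a b c vs} → Adj G a b → Path b c vs → Path a c (a ∷ vs)
  e ◂ [ b ]ᵖ    = e ∷ᵖ [ b ]ᵖ
  e ◂ (e′ ∷ᵖ p) = e ∷ᵖ e′ ∷ᵖ p

  _++ᵖ_ : ∀ {a b c pre ys} → Path a b (pre ++ b ∷ []) → Path b c (b ∷ ys) → Path a c (pre ++ b ∷ ys)
  _++ᵖ_ {pre = []}             [ _ ]ᵖ        q = q
  _++ᵖ_ {pre = _ ∷ []}         (e ∷ᵖ [ _ ]ᵖ) q = e ∷ᵖ q
  _++ᵖ_ {pre = _ ∷ pre@(_ ∷ _)} (e ∷ᵖ p)      q = e ∷ᵖ _++ᵖ_ {pre = pre} p q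

  Path-snoc : ∀ {a w v vs} → Path a w vs → Adj G w v → Path a v (vs ++ v ∷ [])
  Path-snoc [ _ ]ᵖ    e = e ∷ᵖ [ _ ]ᵖ
  Path-snoc (e′ ∷ᵖ p) e = e′ ◂ Path-snoc p e

  Path⇒Linked : ∀ {a c vs} → Path a c vs → Linked (Adj G) vs
  Path⇒Linked [ _ ]ᵖ   = [-]
  Path⇒Linked (e ∷ᵖ p) = e ∷ Path⇒Linked p

  Path⇒Walk : ∀ {A a c vs} → Path a c vs → (∀ {z} → z ∈ˡ vs → z ∈ A) → Walk A a c
  Path⇒Walk [ _ ]ᵖ   _   = ε
  Path⇒Walk (e ∷ᵖ p) ⊆A = (⊆A (here refl) , ⊆A (there (here refl)) , e) ◅ Path⇒Walk p (⊆A ∘ there)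

  start∈ : ∀ {a c vs} → Path a c vs → a ∈ˡ vs
  start∈ [ _ ]ᵖ   = here refl
  start∈ (_ ∷ᵖ _) = here refl

  end∈ : ∀ {a c vs} → Path a c vs → c ∈ˡ vs
  end∈ [ _ ]ᵖ   = here refl
  end∈ (_ ∷ᵖ p) = there (end∈ p)

  Path-snocView : ∀ {a c vs} → Path a c vs → ∃[ pre ] vs ≡ pre ++ c ∷ []
  Path-snocView [ _ ]ᵖ = [] , refl
  Path-snocView (_∷ᵖ_ {a = a} _ p) with Path-snocView p
  ... | pre , eq = a ∷ pre , cong (a ∷_) eq

  Path-interior : ∀ {a c vs} → Path a c vs → a ≢ c → ∃[ I ] vs ≡ a ∷ I ++ c ∷ []
  Path-interior [ _ ]ᵖ   a≢a = contradiction refl a≢a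
  Path-interior (_ ∷ᵖ p) _   with Path-snocView p
  ... | I , eq = I , cong (_ ∷_) eq

  Path-split : ∀ {a c s vs} → Path a c vs → s ∈ˡ vs →
    ∃₂ λ pre post → vs ≡ pre ++ s ∷ post × Path a s (pre ++ s ∷ []) × Path s c (s ∷ post)
  Path-split [ a ]ᵖ   (here refl) = [] , [] , refl , [ a ]ᵖ , [ a ]ᵖ
  Path-split (e ∷ᵖ p) (here refl) = [] , _ , refl , [ _ ]ᵖ , e ∷ᵖ p
  Path-split (_∷ᵖ_ {a = a} e p) (there s∈) with Path-split p s∈
  ... | pre , post , eq , p₁ , p₂ = a ∷ pre , post , cong (a ∷_) eq , e ◂ p₁ , p₂

  erase-loops : ∀ {E : Fin n → Fin n → Set} {P : Fin n → Set} →
    (∀ {b c} → E b c → Adj G b c × P c) →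
    ∀ {a c} → Star E a c → ∃[ xs ] Path a c (a ∷ xs) × Unique (a ∷ xs) × (∀ {z} → z ∈ˡ xs → P z)
  erase-loops step ε = [] , [ _ ]ᵖ , Unique-∷⁺ (λ ()) [] , λ ()
  erase-loops step {a} (e ◅ w) with erase-loops step w
  ... | xs , p , u , P-xs with a ∈ˡ? (_ ∷ xs)
  ...   | yes a∈ with Path-split p a∈
  ...     | pre , post , eq , _ , p₂ =
    post , p₂ , Unique-++⁻ʳ pre (subst Unique eq u) , P-xs ∘ suffix⊆tail pre eq
  erase-loops step {a} (e ◅ w) | xs , p , u , P-xs | no a∉ =
    _ ∷ xs , proj₁ (step e) ∷ᵖ p , Unique-∷⁺ a∉ u ,
    λ { (here refl) → proj₂ (step e) ; (there z∈) → P-xs z∈ }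

  connected⇒walk : ∀ {B a b} → Connected G B → a ∈ B → b ∈ B → Walk B a b
  connected⇒walk (_ , conn) a∈ b∈ = proj₂ (proj₂ (conn _ _ a∈ b∈))

  Biconnected : Subset n → Set
  Biconnected B = Connected G B × NoCutVertex G B

  block⇒biconnected : ∀ {W B} → IsBlock G W B → Biconnected B
  block⇒biconnected (_ , connected , noCut , _) = connected , noCut

  block-maximal : ∀ {W B B′} → IsBlock G W B → B ⊆ B′ → B′ ⊆ W → Biconnected B′ → B′ ⊆ B
  block-maximal (_ , _ , _ , maximal) B⊆B′ B′⊆W (connected , noCut) =
    maximal _ B⊆B′ B′⊆W connected noCut

  biconnected⇒walk-avoiding : ∀ {B t a b} → Biconnected B → a ∈ B → b ∈ B → a ≢ t → b ≢ t →
    DoubleNegation (Walk (B - t) a b)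
  biconnected⇒walk-avoiding {B} {t} {a} {b} (conn , noCut) a∈ b∈ a≢t b≢t ¬walk with t ∈? B
  ... | yes t∈ = noCut t (t∈ , a , b , x∈p∧x≢y⇒x∈p-y a∈ a≢t , x∈p∧x≢y⇒x∈p-y b∈ b≢t ,
                          proj₂ conn a b a∈ b∈ , ¬walk ∘ proj₂ ∘ proj₂)
  ... | no t∉  =
    ¬walk (walk-mono (λ z∈ → x∈p∧x≢y⇒x∈p-y z∈ λ { refl → t∉ z∈ }) (connected⇒walk conn a∈ b∈))

  hub⇒¬IsCutVertex : ∀ {U v h} → (∀ {s} → s ∈ U - v → DoubleNegation (Walk (U - v) s h)) →
    ¬ IsCutVertex G U v
  hub⇒¬IsCutVertex toHub (_ , a , b , a∈ , b∈ , _ , ¬conn) =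
    toHub a∈ λ a⇝h → toHub b∈ λ b⇝h → ¬conn (a∈ , b∈ , a⇝h ◅◅ walk-reverse b⇝h)

  record SimplePath (B : Subset n) (u v : Fin n) : Set where
    constructor simplePath
    field
      {vertices} : List (Fin n)
      path       : Path u v vertices
      unique     : Unique vertices
      inside     : ∀ {z} → z ∈ˡ vertices → z ∈ B
  open SimplePath

  record DisjointPair (B : Subset n) (u v : Fin n) : Set where
    field
      left right : SimplePath B u v
      meet       : ∀ {z} → z ∈ˡ vertices left → z ∈ˡ vertices right → z ≡ u ⊎ z ≡ v
  open DisjointPair

  swap : ∀ {B u v} → DisjointPair B u v → DisjointPair B u v
  swap P = record { left = right P ; right = left P ; meet = λ z∈r z∈l → meet P z∈l z∈r }

  edgePair : ∀ {B u v} → Adj G u v → u ∈ B → v ∈ B → u ≢ v → DisjointPair B u v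
  edgePair {B} {u} {v} e u∈ v∈ u≢v = record { left = edge ; right = edge ; meet = λ z∈ _ → ends z∈ }
    where
    ends : ∀ {z} → z ∈ˡ u ∷ v ∷ [] → z ≡ u ⊎ z ≡ v
    ends (here refl)         = inj₁ refl
    ends (there (here refl)) = inj₂ refl
    edge : SimplePath B u v
    edge = simplePath (e ∷ᵖ [ _ ]ᵖ) (Unique-∷⁺ (λ { (here refl) → u≢v refl }) (Unique-∷⁺ (λ ()) []))
                      (λ { (here refl) → u∈ ; (there (here refl)) → v∈ })

  RouteAvoiding : Subset n → Fin n → Fin n → List (Fin n) → Set
  RouteAvoiding B u v R = ∃[ P ] (∀ {z} → z ∈ˡ vertices {B} {u} {v} P → z ∈ˡ R → z ≡ u)

  record Detour (B : Subset n) (z v : Fin n) (L R : List (Fin n)) : Set where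
    constructor detour
    field
      {tail} : List (Fin n)
      route  : Path z v (z ∷ tail)
      fresh  : Unique (z ∷ tail)
      avoids : ∀ {a} → a ∈ˡ tail → a ∈ B × a ∉ˡ L × a ∉ˡ R

  Detour-swap : ∀ {B z v L R} → Detour B z v L R → Detour B z v R L
  Detour-swap (detour p u avoids) =
    detour p u λ a∈ → let (a∈B , a∉L , a∉R) = avoids a∈ in a∈B , a∉R , a∉L

  splice : ∀ {B u w z v} (P : DisjointPair B u w) → z ∈ˡ vertices (left P) → z ≢ w →
    Detour B z v (vertices (left P)) (vertices (right P)) → RouteAvoiding B u v (vertices (right P))
  splice {B} {u} {w} {z} P z∈ z≢w (detour {zs} pz uz avoids) with Path-split (path (left P)) z∈
  ... | pre , post , eq , p₁ , p₂ = simplePath (p₁ ++ᵖ pz) unique′ inside′ , meet′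
    where
    u₁ : Unique (pre ++ z ∷ post)
    u₁ = subst Unique eq (unique (left P))
    onLeft : ∀ {a} → a ∈ˡ pre → a ∈ˡ vertices (left P)
    onLeft a∈ = subst (_ ∈ˡ_) (≡.sym eq) (∈-++⁺ˡ a∈)
    pre#z∷zs : Disjoint pre (z ∷ zs)
    pre#z∷zs (a∈ , here refl)  = Unique-++⇒Disjoint pre u₁ (a∈ , here refl)
    pre#z∷zs (a∈ , there a∈zs) = proj₁ (proj₂ (avoids a∈zs)) (onLeft a∈)
    unique′ : Unique (pre ++ z ∷ zs)
    unique′ = Unique-++⁺ (Unique-++⁻ˡ pre u₁) uz pre#z∷zs
    inside′ : ∀ {a} → a ∈ˡ pre ++ z ∷ zs → a ∈ B
    inside′ a∈ with ∈-++⁻ pre a∈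
    ... | inj₁ a∈pre          = inside (left P) (onLeft a∈pre)
    ... | inj₂ (here refl)    = inside (left P) z∈
    ... | inj₂ (there a∈zs)   = proj₁ (avoids a∈zs)
    meet′ : ∀ {a} → a ∈ˡ pre ++ z ∷ zs → a ∈ˡ vertices (right P) → a ≡ u
    meet′ a∈ a∈R with ∈-++⁻ pre a∈
    ... | inj₁ a∈pre with meet P (onLeft a∈pre) a∈R
    ...   | inj₁ a≡u  = a≡u
    ...   | inj₂ refl = contradiction (a∈pre , end∈ p₂) (Unique-++⇒Disjoint pre u₁)
    meet′ a∈ a∈R | inj₂ (here refl) with meet P z∈ a∈R
    ...   | inj₁ z≡u  = z≡u
    ...   | inj₂ z≡w  = contradiction z≡w z≢w
    meet′ a∈ a∈R | inj₂ (there a∈zs) = contradiction a∈R (proj₂ (proj₂ (avoids a∈zs)))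

  extend-right : ∀ {B u w v} (P : DisjointPair B u w) → Adj G w v → v ∈ B →
    v ∉ˡ vertices (right P) → RouteAvoiding B u v (vertices (right P)) → DisjointPair B u v
  extend-right {B} {u} {w} {v} P e v∈ v∉ (L , meetL) =
    record { left = L ; right = simplePath (Path-snoc (path R) e) unique′ inside′ ; meet = meet′ }
    where
    R : SimplePath B u w
    R = right P
    unique′ : Unique (vertices R ++ v ∷ [])
    unique′ = Unique-++⁺ (unique R) (Unique-∷⁺ (λ ()) []) λ { (a∈ , here refl) → v∉ a∈ }
    inside′ : ∀ {a} → a ∈ˡ vertices R ++ v ∷ [] → a ∈ B
    inside′ a∈ with ∈-++⁻ (vertices R) a∈
    ... | inj₁ a∈R         = inside R a∈R
    ... | inj₂ (here refl) = v∈
    meet′ : ∀ {a} → a ∈ˡ vertices L → a ∈ˡ vertices R ++ v ∷ [] → a ≡ u ⊎ a ≡ v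
    meet′ a∈L a∈ with ∈-++⁻ (vertices R) a∈
    ... | inj₁ a∈R         = inj₁ (meetL a∈L a∈R)
    ... | inj₂ (here refl) = inj₂ refl

  reroute : ∀ {B u w z v} (P : DisjointPair B u w) → Adj G w v → v ∈ B → v ∉ˡ vertices (right P) →
    z ∈ˡ vertices (left P) → z ≢ w → Detour B z v (vertices (left P)) (vertices (right P)) →
    DisjointPair B u v
  reroute P e v∈ v∉ z∈ z≢w D = extend-right P e v∈ v∉ (splice P z∈ z≢w D)

  StepInto : Subset n → List (Fin n) → Fin n → Fin n → Set
  StepInto A D b c = Adj G b c × c ∈ A × c ∉ˡ D

  lastVisit : ∀ {A D z a c} → z ∈ˡ D → z ∈ A → Star (StepInto A D) z a → Walk A a c →
    ∃[ z′ ] z′ ∈ˡ D × z′ ∈ A × Star (StepInto A D) z′ c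
  lastVisit z∈D z∈A z⇝a ε = _ , z∈D , z∈A , z⇝a
  lastVisit {D = D} z∈D z∈A z⇝a ((_ , b∈ , e) ◅ b⇝c) with _ ∈ˡ? D
  ... | yes b∈D = lastVisit b∈D b∈ ε b⇝c
  ... | no b∉D  = lastVisit z∈D z∈A (z⇝a ◅◅ (e , b∈ , b∉D) ◅ ε) b⇝c

  -- Take a u–v walk avoiding w and the last vertex z on it that lies on one of the two paths; cut
  -- that path at z and continue along the walk, and extend the other path by the edge w v.
  DisjointPair-step : ∀ {B u w v} → DisjointPair B u w → Adj G w v → v ∈ B → u ≢ v → u ≢ w →
    Walk (B - w) u v → DisjointPair B u v
  DisjointPair-step {B} {u} {w} {v} P e v∈ u≢v u≢w u⇝v = cases (v ∈ˡ? L) (v ∈ˡ? R)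
    where
    L R : List (Fin n)
    L = vertices (left P)
    R = vertices (right P)
    v≢w : v ≢ w
    v≢w refl = irrefl G e
    trivialDetour : ∀ {L′ R′} → Detour B v v L′ R′
    trivialDetour = detour [ v ]ᵖ (Unique-∷⁺ (λ ()) []) λ ()
    u∈L : u ∈ˡ L
    u∈L = start∈ (path (left P))
    avoids : ∀ {xs} → (∀ {a} → a ∈ˡ xs → a ∈ B - w × a ∉ˡ L ++ R) →
      ∀ {a} → a ∈ˡ xs → a ∈ B × a ∉ˡ L × a ∉ˡ R
    avoids new a∈ = let (a∈B-w , a∉) = new a∈ in x∈p-y⇒x∈p a∈B-w , a∉ ∘ ∈-++⁺ˡ , a∉ ∘ ∈-++⁺ʳ L
    cases : Dec (v ∈ˡ L) → Dec (v ∈ˡ R) → DisjointPair B u v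
    cases (yes v∈L) (yes v∈R) = ⊥-elim ([ (λ v≡u → u≢v (≡.sym v≡u)) , v≢w ]′ (meet P v∈L v∈R))
    cases (yes v∈L) (no v∉R)  = reroute P e v∈ v∉R v∈L v≢w trivialDetour
    cases (no v∉L)  (yes v∈R) = reroute (swap P) e v∈ v∉L v∈R v≢w trivialDetour
    cases (no v∉L)  (no v∉R)
      with lastVisit (∈-++⁺ˡ u∈L) (x∈p∧x≢y⇒x∈p-y (inside (left P) u∈L) u≢w) ε u⇝v
    ... | z , z∈D , z∈ , z⇝v with erase-loops (λ s → s) z⇝v | ∈-++⁻ L z∈D
    ...   | _ , pz , uz , new | inj₁ z∈L =
      reroute P e v∈ v∉R z∈L (x∈p-y⇒x≢y z∈) (detour pz uz (avoids new))
    ...   | _ , pz , uz , new | inj₂ z∈R =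
      reroute (swap P) e v∈ v∉L z∈R (x∈p-y⇒x≢y z∈) (Detour-swap (detour pz uz (avoids new)))

  biconnected⇒DisjointPair : ∀ {B u v} → Biconnected B → u ∈ B → v ∈ B → u ≢ v →
    DoubleNegation (DisjointPair B u v)
  biconnected⇒DisjointPair {B} {u} bic u∈ v∈ = grow (connected⇒walk (proj₁ bic) v∈ u∈) v∈
    where
    grow : ∀ {v} → Walk B v u → v ∈ B → u ≢ v → DoubleNegation (DisjointPair B u v)
    grow ε _ u≢u = contradiction refl u≢u
    grow (_◅_ {j = w} (_ , w∈ , e) w⇝u) v∈ u≢v with w ≟ u
    ... | yes refl = pure (edgePair (sym G e) u∈ v∈ u≢v)
    ... | no w≢u   = do
      P   ← grow w⇝u w∈ (w≢u ∘ ≡.sym)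
      u⇝v ← biconnected⇒walk-avoiding bic u∈ v∈ (w≢u ∘ ≡.sym) (λ { refl → irrefl G e })
      pure (DisjointPair-step P (sym G e) v∈ u≢v (w≢u ∘ ≡.sym) u⇝v)

  SimplePath⇒IsPathAvoiding : ∀ {B S u v} → B ⊆ ∁ S → u ≢ v → (P : SimplePath B u v) →
    ∃[ I ] vertices P ≡ u ∷ I ++ v ∷ [] × IsPathAvoiding G S u v I
  SimplePath⇒IsPathAvoiding B⊆∁S u≢v (simplePath p uniq inB) with Path-interior p u≢v
  ... | I , eq = I , eq , subst (Linked (Adj G)) eq (Path⇒Linked p) , subst Unique eq uniq ,
                 All.tabulate (λ z∈ → x∈∁p⇒x∉p (B⊆∁S (inB (subst (_ ∈ˡ_) (≡.sym eq) z∈))))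

  DisjointPair⇒TwoDisjointPaths : ∀ {B S u v} → B ⊆ ∁ S → u ≢ v → DisjointPair B u v →
    TwoDisjointPaths G S u v
  DisjointPair⇒TwoDisjointPaths B⊆∁S u≢v P
    with SimplePath⇒IsPathAvoiding B⊆∁S u≢v (left P) | SimplePath⇒IsPathAvoiding B⊆∁S u≢v (right P)
  ... | I₁ , eq₁ , P₁ | I₂ , eq₂ , P₂ = I₁ , I₂ , P₁ , P₂ , interiors-disjoint
    where
    P₁-unique : Unique (_ ∷ I₁ ++ _ ∷ [])
    P₁-unique = proj₁ (proj₂ P₁)
    interiors-disjoint : ∀ z → z ∈ˡ I₁ → ¬ z ∈ˡ I₂
    interiors-disjoint z z∈₁ z∈₂
      with meet P (subst (z ∈ˡ_) (≡.sym eq₁) (there (∈-++⁺ˡ z∈₁)))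
                  (subst (z ∈ˡ_) (≡.sym eq₂) (there (∈-++⁺ˡ z∈₂)))
    ... | inj₁ refl = Unique[x∷xs]⇒x∉xs P₁-unique (∈-++⁺ˡ z∈₁)
    ... | inj₂ refl = Unique-++⇒Disjoint (_ ∷ I₁) P₁-unique (there z∈₁ , here refl)

  -- U = B ∪ B′ ∪ γ is 2-connected: without t everything reaches q, without any other vertex
  -- everything reaches t. Maximality of B and B′ then forces B = B′.
  module BlockUnion {W B B′ t q p} (B-block : IsBlock G W B) (B′-block : IsBlock G W B′)
    (t∈B : t ∈ B) (t∈B′ : t ∈ B′) (q∈ : q ∈ B - t) (p∈ : p ∈ B′ - t)
    {vs} (γ : Path q p vs) (γ-unique : Unique vs) (γ⊆W-t : ∀ {z} → z ∈ˡ vs → z ∈ W - t) where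

    InUnion : Fin n → Set
    InUnion i = i ∈ B ⊎ i ∈ B′ ⊎ i ∈ˡ vs

    InUnion? : Decidable InUnion
    InUnion? i = i ∈? B ⊎-dec i ∈? B′ ⊎-dec i ∈ˡ? vs

    U : Subset n
    U = fromDec InUnion?

    U⁻ : ∀ {i} → i ∈ U → InUnion i
    U⁻ = ∈-fromDec⁻ InUnion?

    B⊆U : B ⊆ U
    B⊆U = ∈-fromDec⁺ InUnion? ∘ inj₁

    B′⊆U : B′ ⊆ U
    B′⊆U = ∈-fromDec⁺ InUnion? ∘ inj₂ ∘ inj₁

    γ⊆U : ∀ {z} → z ∈ˡ vs → z ∈ U
    γ⊆U = ∈-fromDec⁺ InUnion? ∘ inj₂ ∘ inj₂

    U⊆W : U ⊆ W
    U⊆W i∈ with U⁻ i∈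
    ... | inj₁ i∈B         = proj₁ B-block i∈B
    ... | inj₂ (inj₁ i∈B′) = proj₁ B′-block i∈B′
    ... | inj₂ (inj₂ i∈γ)  = x∈p-y⇒x∈p (γ⊆W-t i∈γ)

    along : ∀ {v a c ws} → Path a c ws → (∀ {z} → z ∈ˡ ws → z ∈ˡ vs) → (∀ {z} → z ∈ˡ ws → z ≢ v) →
      Walk (U - v) a c
    along seg seg⊆γ ≢v = Path⇒Walk seg λ z∈ → x∈p∧x≢y⇒x∈p-y (γ⊆U (seg⊆γ z∈)) (≢v z∈)

    γ≢t : ∀ {z} → z ∈ˡ vs → z ≢ t
    γ≢t = x∈p-y⇒x≢y ∘ γ⊆W-t

    B-bic : Biconnected B
    B-bic = block⇒biconnected B-block

    B′-bic : Biconnected B′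
    B′-bic = block⇒biconnected B′-block

    walk-to-t : ∀ {s} → s ∈ U → Walk U s t
    walk-to-t s∈ with U⁻ s∈
    ... | inj₁ s∈B         = walk-mono B⊆U (connected⇒walk (proj₁ B-bic) s∈B t∈B)
    ... | inj₂ (inj₁ s∈B′) = walk-mono B′⊆U (connected⇒walk (proj₁ B′-bic) s∈B′ t∈B′)
    ... | inj₂ (inj₂ s∈γ) with Path-split γ s∈γ
    ...   | _ , _ , eq , q⇝s , _ =
      walk-reverse (Path⇒Walk q⇝s (γ⊆U ∘ ∈-prefix eq)) ◅◅
      walk-mono B⊆U (connected⇒walk (proj₁ B-bic) (x∈p-y⇒x∈p q∈) t∈B)

    walk-to-q-avoiding-t : ∀ {s} → s ∈ U - t → DoubleNegation (Walk (U - t) s q)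
    walk-to-q-avoiding-t s∈ with U⁻ (x∈p-y⇒x∈p s∈)
    ... | inj₁ s∈B =
      walk-mono (p⊆q⇒p-y⊆q-y B⊆U) <$>
        biconnected⇒walk-avoiding B-bic s∈B (x∈p-y⇒x∈p q∈) (x∈p-y⇒x≢y s∈) (x∈p-y⇒x≢y q∈)
    ... | inj₂ (inj₁ s∈B′) =
      (λ s⇝p → walk-mono (p⊆q⇒p-y⊆q-y B′⊆U) s⇝p ◅◅ walk-reverse (along γ id γ≢t)) <$>
        biconnected⇒walk-avoiding B′-bic s∈B′ (x∈p-y⇒x∈p p∈) (x∈p-y⇒x≢y s∈) (x∈p-y⇒x≢y p∈)
    ... | inj₂ (inj₂ s∈γ) with Path-split γ s∈γ
    ...   | _ , _ , eq , q⇝s , _ = pure (walk-reverse (along q⇝s (∈-prefix eq) (γ≢t ∘ ∈-prefix eq)))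

    walk-along-γ-to-t : ∀ {v s} → t ≢ v → s ∈ˡ vs → s ≢ v → DoubleNegation (Walk (U - v) s t)
    walk-along-γ-to-t {v} t≢v s∈γ s≢v with Path-split γ s∈γ
    ... | pre , post , eq , q⇝s , s⇝p with v ∈ˡ? pre
    ...   | yes v∈pre =
      (λ p⇝t → along s⇝p (∈-suffix eq) ≢v ◅◅ walk-mono (p⊆q⇒p-y⊆q-y B′⊆U) p⇝t) <$>
        biconnected⇒walk-avoiding B′-bic (x∈p-y⇒x∈p p∈) t∈B′ (≢v (end∈ s⇝p)) t≢v
      where
      ≢v : ∀ {z} → z ∈ˡ _ ∷ post → z ≢ v
      ≢v z∈ refl = Unique-++⇒Disjoint pre (subst Unique eq γ-unique) (v∈pre , z∈)
    ...   | no v∉pre =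
      (λ q⇝t → walk-reverse (along q⇝s (∈-prefix eq) ≢v) ◅◅ walk-mono (p⊆q⇒p-y⊆q-y B⊆U) q⇝t) <$>
        biconnected⇒walk-avoiding B-bic (x∈p-y⇒x∈p q∈) t∈B (≢v (start∈ q⇝s)) t≢v
      where
      ≢v : ∀ {z} → z ∈ˡ pre ++ _ ∷ [] → z ≢ v
      ≢v z∈ refl with ∈-++⁻ pre z∈
      ... | inj₁ v∈pre      = v∉pre v∈pre
      ... | inj₂ (here v≡s) = s≢v (≡.sym v≡s)

    walk-to-t-avoiding : ∀ {v s} → t ≢ v → s ∈ U - v → DoubleNegation (Walk (U - v) s t)
    walk-to-t-avoiding t≢v s∈ with U⁻ (x∈p-y⇒x∈p s∈)
    ... | inj₁ s∈B =
      walk-mono (p⊆q⇒p-y⊆q-y B⊆U) <$> biconnected⇒walk-avoiding B-bic s∈B t∈B (x∈p-y⇒x≢y s∈) t≢v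
    ... | inj₂ (inj₁ s∈B′) =
      walk-mono (p⊆q⇒p-y⊆q-y B′⊆U) <$> biconnected⇒walk-avoiding B′-bic s∈B′ t∈B′ (x∈p-y⇒x≢y s∈) t≢v
    ... | inj₂ (inj₂ s∈γ) = walk-along-γ-to-t t≢v s∈γ (x∈p-y⇒x≢y s∈)

    U-biconnected : Biconnected U
    U-biconnected = ((t , B⊆U t∈B) , connected) , noCut
      where
      connected : ∀ a b → a ∈ U → b ∈ U → ConnIn G U a b
      connected _ _ a∈ b∈ = a∈ , b∈ , walk-to-t a∈ ◅◅ walk-reverse (walk-to-t b∈)
      noCut : NoCutVertex G U
      noCut v with v ≟ t
      ... | yes refl = hub⇒¬IsCutVertex walk-to-q-avoiding-t
      ... | no v≢t   = hub⇒¬IsCutVertex (walk-to-t-avoiding (v≢t ∘ ≡.sym))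

    blocks-coincide : B ≡ B′
    blocks-coincide = ⊆-antisym (block-maximal B′-block B′⊆B (proj₁ B-block) B-bic) B′⊆B
      where
      B′⊆B : B′ ⊆ B
      B′⊆B = block-maximal B-block B⊆U U⊆W U-biconnected ∘ B′⊆U

  blocks-joined-avoiding-shared-vertex-≡ : ∀ {W B B′ t q p} → IsBlock G W B → IsBlock G W B′ →
    t ∈ B → t ∈ B′ → q ∈ B - t → p ∈ B′ - t → Walk (W - t) q p → B ≡ B′
  blocks-joined-avoiding-shared-vertex-≡ {W} {t = t} {q} B-block B′-block t∈B t∈B′ q∈ p∈ q⇝p
    with erase-loops (λ (_ , c∈ , e) → e , c∈) q⇝p
  ... | xs , γ , γ-unique , tail⊆W-t =
    BlockUnion.blocks-coincide B-block B′-block t∈B t∈B′ q∈ p∈ γ γ-unique γ⊆W-t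
    where
    γ⊆W-t : ∀ {z} → z ∈ˡ q ∷ xs → z ∈ W - t
    γ⊆W-t (here refl) = x∈p∧x≢y⇒x∈p-y (proj₁ B-block (x∈p-y⇒x∈p q∈)) (x∈p-y⇒x≢y q∈)
    γ⊆W-t (there z∈)  = tail⊆W-t z∈

  module Reachability {W B t} (B-block : IsBlock G W B) (t∈B : t ∈ B) where

    Reachable : Fin n → Set
    Reachable p = ∃[ q ] q ∈ B - t × Walk (W - t) q p

    _∋_ : BCNode G → Fin n → Set
    inj₁ a ∋ p = p ≡ a
    inj₂ C ∋ p = p ∈ C

    AllReachable NoneReachable : BCNode G → Set
    AllReachable  N = ∀ p → N ∋ p → p ≢ t → DoubleNegation (Reachable p)
    NoneReachable N = ∀ p → N ∋ p → p ≢ t → ¬ Reachable p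

    AllReachable-B : AllReachable (inj₂ B)
    AllReachable-B p p∈B p≢t = pure (p , x∈p∧x≢y⇒x∈p-y p∈B p≢t , ε)

    NoneReachable-t : NoneReachable (inj₁ t)
    NoneReachable-t p p≡t p≢t = contradiction p≡t p≢t

    AllReachable-step : ∀ {N M} → BCAdjAvoiding G W (inj₁ t) N M → AllReachable N → AllReachable M
    AllReachable-step (cut-blk {a} _ C-block a∈C , N≢t , _) all p p∈C p≢t = do
      (q , q∈ , q⇝a) ← all a refl a≢t
      a⇝p ← biconnected⇒walk-avoiding (block⇒biconnected C-block) a∈C p∈C a≢t p≢t
      pure (q , q∈ , q⇝a ◅◅ walk-mono (p⊆q⇒p-y⊆q-y (proj₁ C-block)) a⇝p)
      where
      a≢t : a ≢ t
      a≢t = N≢t ∘ cong inj₁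
    AllReachable-step (blk-cut _ _ p∈C , _) all p refl = all p p∈C

    NoneReachable-step : ∀ {N M} → BCAdjAvoiding G W (inj₂ B) N M →
      NoneReachable N → NoneReachable M
    NoneReachable-step (cut-blk {a} _ C-block a∈C , _ , C≢B) none p p∈C p≢t (q , q∈ , q⇝p)
      with a ≟ t
    ... | yes refl = C≢B (cong inj₂ (≡.sym (blocks-joined-avoiding-shared-vertex-≡
          B-block C-block t∈B a∈C q∈ (x∈p∧x≢y⇒x∈p-y p∈C p≢t) q⇝p)))
    ... | no a≢t   = biconnected⇒walk-avoiding (block⇒biconnected C-block) p∈C a∈C p≢t a≢t λ p⇝a →
          none a refl a≢t (q , q∈ , q⇝p ◅◅ walk-mono (p⊆q⇒p-y⊆q-y (proj₁ C-block)) p⇝a)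
    NoneReachable-step (blk-cut _ _ p∈C , _) none p refl = none p p∈C

  ParentOf-asym : ∀ {W} (F : RootedBCForest G W) {t B} →
    ParentOf G F (inj₁ t) (inj₂ B) → ¬ ParentOf G F (inj₂ B) (inj₁ t)
  ParentOf-asym F {t} (blk-cut t-cut B-block t∈B , R , R-root , t⇝R) (_ , R′ , R′-root , B⇝R′)
    with RootedBCForest.root-unique F (inj₁ t) R R′ R-root R′-root
           (Star.map proj₁ t⇝R) (cut-blk t-cut B-block t∈B ◅ Star.map proj₁ B⇝R′)
  ... | refl with Star-last B⇝R′
  ...   | inj₂ (_ , cut-blk {a} _ _ a∈R , N≢t , _) = all-R a a∈R a≢t (none-R a a∈R a≢t)
    where
    open Reachability B-block t∈B
    all-R : AllReachable (inj₂ R)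
    all-R = transport-along AllReachable AllReachable-step B⇝R′ AllReachable-B
    none-R : NoneReachable (inj₂ R)
    none-R = transport-along NoneReachable NoneReachable-step t⇝R NoneReachable-t
    a≢t : a ≢ t
    a≢t = N≢t ∘ cong inj₁
  ...   | inj₁ refl with Star-last t⇝R
  ...     | inj₂ (_ , _ , _ , R≢B) = R≢B refl

proposition4p2 : (n : ℕ) (G : Graph n) (T : Subset n) (x : Fin n) →
    IsMultiwayNearSeparator G T ⁅ x ⁆ →
    (F : RootedBCForest G (∁ ⁅ x ⁆)) →
    (t : Fin n) → t ∈ T → IsCutVertex G (∁ ⁅ x ⁆) t →
    (c : Fin n) → IsGrandchild G F t c → c ∉ T
proposition4p2 n G T x sep F t t∈T _ c (inj₁ _ , (() , _) , _)
proposition4p2 n G T x (_ , separates) F t t∈T _ c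
  (inj₂ B , t-parent@(blk-cut _ B-block t∈B , _) , B-parent@(cut-blk _ _ c∈B , _)) c∈T with c ≟ t
... | yes refl = ParentOf-asym G F t-parent B-parent
... | no c≢t   = biconnected⇒DisjointPair G (block⇒biconnected G B-block) t∈B c∈B t≢c λ P →
                   separates t c t∈T c∈T t≢c (DisjointPair⇒TwoDisjointPaths G (proj₁ B-block) t≢c P)
  where
  t≢c : t ≢ c
  t≢c = c≢t ∘ ≡.sym
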